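{- Let $S$ be a scheduling problem on $n$ items. Then $$1+t\sum_{k\ge 0}\chi_S(k)\,t^k=\frac{h_{\mathrm{Allow}(S)}(t)}{(1-t)^{n+1}}\qquad\text{and}\qquad 1+t\sum_{k\ge 0}\bigl(k^n-\chi_S(k)\bigr)t^k=\frac{h_{\mathrm{Forb}(S)}(t)}{(1-t)^{n+1}}.$$ Equivalently, the $h$-vector of the shifted polynomial $\chi_S(k-1)$ equals the $h$-vector of the allowed configuration $\mathrm{Allow}(S)$, and the $h$-vector of the polynomial $(k-1)^n-\chi_S(k-1)$ equals the $h$-vector of the forbidden configuration $\mathrm{Forb}(S)$.
   Context: Let $n\ge1$, $[n]=\{1,\dots,n\}$. A scheduling problem on $n$ items is a boolean formula $S$ in variables $x_1,\dots,x_n$ built from atomic formulas $x_i\le x_j$ ($i,j\in[n]$) by boolean connectives; $\chi_S(k)$ is the number of $a\in[k]^n$ such that $S$ is true when $x_i=a_i$ for all $i$ (with $\chi_S(0)=0$). An ordered set partition of $[n]$ is a sequence $\Phi=(\Phi_1|\cdots|\Phi_\ell)$ of nonempty pairwise disjoint blocks with union $[n]$; $\ell(\Phi)=\ell$ is its length. For $a\in\mathbb{R}^n$, $\Delta(a)$ is the ordered set partition such that $a$ is constant on each block and strictly increasing from block to block. $\Phi$ solves $S$ if $S$ holds at some (equivalently every) $a$ with $\Delta(a)=\Phi$. For each ordered set partition $\Phi$, let $\sigma_\Phi=\{x\in(0,1)^n:\Delta(x)=\Phi\}$; this is a relatively open unimodular simplex of dimension $\ell(\Phi)$, and these simplices form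 a triangulation $T$ of the open cube $(0,1)^n$ (induced by the braid arrangement $x_i=x_j$). The allowed configuration is $\mathrm{Allow}(S)=\{\sigma_\Phi:\Phi\text{ solves }S\}$ and the forbidden configuration is $\mathrm{Forb}(S)=\{\sigma_\Phi:\Phi\text{ does not solve }S\}$. For a collection $K$ of faces of $T$, let $f_i$ be the number of $i$-dimensional faces in $K$ ($1\le i\le n$) and define its $h$-polynomial $h_K(t)=\sum_{i=0}^{n+1}h_i(K)t^i$ by $$1+\sum_{k\ge1}\Bigl(\sum_{i=1}^n f_i\binom{k-1}{i}\Bigr)t^k=\frac{h_K(t)}{(1-t)^{n+1}}$$ (the inner sum is the Ehrhart function $k\mapsto\#(\mathbb{Z}^n\cap k\cdot\bigcup K)$). For a polynomial $p$ written $p(k)=\sum_i f_i\binom{k-1}{i}$, its $h$-vector is defined by $1+\sum_{k\ge1}p(k)t^k=\sum_i h_it^i/(1-t)^{n+1}$. -}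

module Defs where

open import Data.Nat using (ℕ; zero; suc; _∸_; _^_; _≡ᵇ_)
open import Data.Nat.Combinatorics using (_C_)
open import Data.Integer using (ℤ; +_; -_) renaming (_+_ to _+ℤ_; _*_ to _*ℤ_; _-_ to _-ℤ_)
open import Data.Fin using (Fin)
open import Data.Vec using (Vec; []; _∷_; lookup; toList)
open import Data.List using (List; []; _∷_; _++_; map; concatMap; upTo)
open import Data.Bool.ListAction using (all; any)
open import Data.Bool using (Bool; true; false; not; _∧_; _∨_; if_then_else_)

-- Scheduling problems: boolean formulas in x₁,…,xₙ built from atoms xᵢ ≤ xⱼ

infix 25 ¬f_
infixr 24 _∧f_
infixr 23 _∨f_
infixr 22 _⇒f_ _⇔f_

data Formula (n : ℕ) : Set where
  atom  : Fin n → Fin n → Formula n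
  ⊤f ⊥f : Formula n
  ¬f_   : Formula n → Formula n
  _∧f_ _∨f_ _⇒f_ _⇔f_ : Formula n → Formula n → Formula n

eval : ∀ {n} → Formula n → Vec ℕ n → Bool
eval (atom i j) a = lookup a i Data.Nat.≤ᵇ lookup a j
eval ⊤f a = true
eval ⊥f a = false
eval (¬f S) a = not (eval S a)
eval (S ∧f T) a = eval S a ∧ eval T a
eval (S ∨f T) a = eval S a ∨ eval T a
eval (S ⇒f T) a = not (eval S a) ∨ eval T a
eval (S ⇔f T) a = (eval S a ∧ eval T a) ∨ (not (eval S a) ∧ not (eval T a))

cube : (n k : ℕ) → List (Vec ℕ n)
cube zero    k = [] ∷ []
cube (suc n) k = concatMap (λ v → map (λ x → suc x ∷ v) (upTo k)) (cube n k)

countB : ∀ {A : Set} → (A → Bool) → List A → ℕ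
countB p []       = 0
countB p (x ∷ xs) = if p x then suc (countB p xs) else countB p xs

-- χ_S(k) = #{ a ∈ [k]^n : S(a) }   (for n ≥ 1, χ_S(0) = 0 automatically)
χ : ∀ {n} → Formula n → ℕ → ℕ
χ {n} S k = countB (eval S) (cube n k)

-- Ordered set partitions of [n] of length ℓ, encoded as surjections
-- [n] → [ℓ] (vectors b ∈ [ℓ]^n hitting every value 1,…,ℓ):
-- Φ_j = { i : b_i = j }.  Then b itself is a point with Δ(b) = Φ,
-- so Φ solves S iff S holds at b.

isSurj : ∀ {n} → ℕ → Vec ℕ n → Bool
isSurj ℓ b = all (λ j → any (λ x → x ≡ᵇ suc j) (toList b)) (upTo ℓ)

solves : ∀ {n} → Formula n → Vec ℕ n → Bool
solves S b = eval S b

-- A configuration is given by a predicate on ordered set partitions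
-- (which simplices σ_Φ it contains).  dim σ_Φ = ℓ(Φ).
Config : ℕ → Set
Config n = Vec ℕ n → Bool

Allow : ∀ {n} → Formula n → Config n
Allow S b = solves S b

Forb : ∀ {n} → Formula n → Config n
Forb S b = not (solves S b)

fvec : ∀ {n} → Config n → ℕ → ℕ
fvec {n} K i = countB (λ b → isSurj i b ∧ K b) (cube n i)

Series : Set
Series = ℕ → ℤ

sumTo : ℕ → (ℕ → ℤ) → ℤ
sumTo zero    f = + 0
sumTo (suc m) f = sumTo m f +ℤ f m

sign : ℕ → ℤ
sign zero    = + 1
sign (suc j) = - sign j

-- multiplication by (1 - t)^(N)
mulOneMinusTPow : ℕ → Series → Series
mulOneMinusTPow N s m = sumTo (suc m) (λ j → sign j *ℤ (+ (N C j)) *ℤ s (m ∸ j))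

-- division by (1 - t)^(n+1), i.e. multiplication by Σ_m C(m+n,n) t^m
divOneMinusTPowSuc : ℕ → Series → Series
divOneMinusTPowSuc n s m = sumTo (suc m) (λ i → s i *ℤ (+ ((m ∸ i + n) C n)))
  where open Data.Nat using (_+_)

-- 1 + Σ_{k≥1} (Σ_{i=1}^n f_i C(k-1,i)) t^k   (Ehrhart series of ⋃K)
ehrhartSeries : ∀ {n} → Config n → Series
ehrhartSeries K zero    = + 1
ehrhartSeries {n} K (suc k) = sumTo n (λ i → + (fvec K (suc i) Data.Nat.* (k C suc i)))

-- h-polynomial of K (coefficient sequence): the unique h with
-- ehrhartSeries K = h(t) / (1 - t)^(n+1), i.e. h = (1-t)^(n+1) · ehrhartSeries K
hPoly : ∀ {n} → Config n → Series
hPoly {n} K = mulOneMinusTPow (suc n) (ehrhartSeries K)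

onePlusT : (ℕ → ℤ) → Series
onePlusT p zero    = + 1
onePlusT p (suc k) = p k

-- Since hPoly K is (1 - t)^(n+1) times the Ehrhart series of K, both identities say that the
-- Ehrhart series counts lattice points: for an order-invariant configuration K (one depending
-- only on Δ(a), such as Allow S or Forb S = Allow (¬ S)), #{a ∈ [k]^n : K a} = Σ_ℓ f_ℓ(K) C(k, ℓ).
-- Let W(d, k) count the points of [d + k]^n in K taking every value 1, …, d; then W(0, k) is the
-- left side and W(ℓ, 0) = f_ℓ(K). Splitting on whether a point takes the value d + 1 gives
-- Pascal's rule W(d, k + 1) = W(d, k) + W(d + 1, k): a point avoiding d + 1 corresponds, by
-- lowering every larger value by one, to a point of [d + k]^n with the same relative order.
-- Hence W(0, k) = Σ_j C(k, j) W(j, 0), and f_j vanishes for j = 0 and, by pigeonhole, for j > n.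

module Submission where

open import Defs
open import Data.Nat as ℕ using (ℕ; zero; suc; _≤_; _<_; _≤ᵇ_; _≡ᵇ_; _⊔_; _^_; _∸_; s≤s)
import Data.Nat.Properties as ℕ
open import Data.Nat.Combinatorics using (_C_; nCn≡1; nCk+nC[k+1]≡[n+1]C[k+1])
open import Data.Integer using (ℤ; +_; -_; _+_; _-_; _*_)
import Data.Integer.Properties as ℤ
open import Data.Integer.Solver using (module +-*-Solver)
open import Data.Bool using (Bool; true; false; not; _∧_; _∨_; if_then_else_; T)
open import Data.Bool.Properties using (∧-assoc; ∧-comm; ∧-identityʳ; ∧-zeroʳ; T-not-≡)
open import Data.Bool.ListAction using (all; any; or)
open import Data.Fin as Fin using (Fin; toℕ)
import Data.Fin.Properties as Fin
open import Data.Vec as Vec using (Vec; _∷_; lookup; toList)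
import Data.Vec.Properties as Vec
open import Data.List using (List; []; _∷_; _++_; [_]; _∷ʳ_; map; concatMap; upTo; filterᵇ; length)
import Data.List.Properties as List
import Data.List.Relation.Unary.All as All
open import Data.List.Relation.Unary.All.Properties using (all⁺)
open import Data.List.Membership.Propositional.Properties using (∈-upTo⁺)
open import Data.Product using (∃-syntax; _×_; _,_; proj₁; proj₂)
open import Data.Sum using (inj₁; inj₂)
open import Data.Unit using (tt)
open import Data.Empty using (⊥-elim)
open import Function using (_∘_; Equivalence)
open import Relation.Binary.Core using (_Preserves_⟶_)
open import Relation.Nullary using (yes; no)
open import Relation.Nullary.Decidable using (T?)
open import Relation.Nullary.Reflects using (Reflects; ofʸ; ofⁿ; det; fromEquivalence)
open import Relation.Binary.PropositionalEquality hiding ([_])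

open +-*-Solver

private variable
  A B : Set

-- Finite sums

sumTo-cong : ∀ m {f g : ℕ → ℤ} → (∀ i → i < m → f i ≡ g i) → sumTo m f ≡ sumTo m g
sumTo-cong zero    f≡g = refl
sumTo-cong (suc m) f≡g =
  cong₂ _+_ (sumTo-cong m (λ i i<m → f≡g i (ℕ.m≤n⇒m≤1+n i<m))) (f≡g m ℕ.≤-refl)

sumTo-suc-head : ∀ m (f : ℕ → ℤ) → sumTo (suc m) f ≡ f 0 + sumTo m (λ i → f (suc i))
sumTo-suc-head zero    f = trans (ℤ.+-identityˡ (f 0)) (sym (ℤ.+-identityʳ (f 0)))
sumTo-suc-head (suc m) f = trans (cong (_+ f (suc m)) (sumTo-suc-head m f)) (ℤ.+-assoc (f 0) _ _)

sumTo-+ : ∀ m (f g : ℕ → ℤ) → sumTo m (λ i → f i + g i) ≡ sumTo m f + sumTo m g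
sumTo-+ zero    f g = refl
sumTo-+ (suc m) f g = trans (cong (_+ (f m + g m)) (sumTo-+ m f g))
  (solve 4 (λ a b c d → (a :+ b) :+ (c :+ d) := (a :+ c) :+ (b :+ d)) refl
    (sumTo m f) (sumTo m g) (f m) (g m))

sumTo-neg : ∀ m (f : ℕ → ℤ) → sumTo m (λ i → - f i) ≡ - sumTo m f
sumTo-neg zero    f = refl
sumTo-neg (suc m) f =
  trans (cong (_+ - f m) (sumTo-neg m f)) (sym (ℤ.neg-distrib-+ (sumTo m f) (f m)))

sumTo-zero : ∀ m {f : ℕ → ℤ} → (∀ i → f i ≡ + 0) → sumTo m f ≡ + 0
sumTo-zero zero    f≡0 = refl
sumTo-zero (suc m) f≡0 = cong₂ _+_ (sumTo-zero m f≡0) (f≡0 m)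

sumTo-stable : ∀ {N} M {a : ℕ → ℤ} → (∀ j → N ≤ j → a j ≡ + 0) → N ≤ M → sumTo M a ≡ sumTo N a
sumTo-stable zero    a≡0 ℕ.z≤n = refl
sumTo-stable (suc M) a≡0 N≤M+1 with ℕ.m≤n⇒m<n∨m≡n N≤M+1
... | inj₂ refl      = refl
... | inj₁ (s≤s N≤M) = trans (cong₂ _+_ (sumTo-stable M a≡0 N≤M) (a≡0 M N≤M)) (ℤ.+-identityʳ _)

pascal : ∀ n k → + (suc n C suc k) ≡ + (n C k) + + (n C suc k)
pascal n k = trans (cong +_ (sym (nCk+nC[k+1]≡[n+1]C[k+1] n k))) (ℤ.pos-+ (n C k) (n C suc k))

sumTo-pascal : ∀ k N (f : ℕ → ℤ) →
  sumTo (suc N) (λ j → + (suc k C j) * f j)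
    ≡ sumTo (suc N) (λ j → + (k C j) * f j) + sumTo N (λ j → + (k C j) * f (suc j))
sumTo-pascal k N f = begin
  sumTo (suc N) (λ j → + (suc k C j) * f j)
    ≡⟨ sumTo-suc-head N _ ⟩
  + 1 * f 0 + sumTo N (λ j → + (suc k C suc j) * f (suc j))
    ≡⟨ cong (λ z → + 1 * f 0 + z) (trans (sumTo-cong N (λ j _ → split j)) (sumTo-+ N t₁ t₂)) ⟩
  + 1 * f 0 + (sumTo N t₁ + sumTo N t₂)
    ≡⟨ solve 3 (λ x a b → x :+ (a :+ b) := (x :+ b) :+ a) refl (+ 1 * f 0) (sumTo N t₁) (sumTo N t₂) ⟩
  (+ 1 * f 0 + sumTo N t₂) + sumTo N t₁
    ≡⟨ cong (_+ sumTo N t₁) (sumTo-suc-head N (λ j → + (k C j) * f j)) ⟨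
  sumTo (suc N) (λ j → + (k C j) * f j) + sumTo N t₁ ∎
  where
  open ≡-Reasoning
  t₁ t₂ : ℕ → ℤ
  t₁ j = + (k C j) * f (suc j)
  t₂ j = + (k C suc j) * f (suc j)
  split : ∀ j → + (suc k C suc j) * f (suc j) ≡ t₁ j + t₂ j
  split j = trans (cong (_* f (suc j)) (pascal k j))
                  (ℤ.*-distribʳ-+ (f (suc j)) (+ (k C j)) (+ (k C suc j)))

binomial-of-pascal : (W : ℕ → ℕ → ℤ) → (∀ d k → W d (suc k) ≡ W d k + W (suc d) k) →
  ∀ k d N → k < N → W d k ≡ sumTo N (λ j → + (k C j) * W (d ℕ.+ j) 0)
binomial-of-pascal W W-suc zero d (suc N) _ = begin
  W d 0
    ≡⟨ cong (λ z → W z 0) (ℕ.+-identityʳ d) ⟨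
  W (d ℕ.+ 0) 0
    ≡⟨ ℤ.+-identityʳ _ ⟨
  W (d ℕ.+ 0) 0 + + 0
    ≡⟨ cong₂ _+_ (ℤ.*-identityˡ (W (d ℕ.+ 0) 0)) (sumTo-zero N (λ j → ℤ.*-zeroˡ (W (d ℕ.+ suc j) 0))) ⟨
  + 1 * W (d ℕ.+ 0) 0 + sumTo N (λ j → + 0 * W (d ℕ.+ suc j) 0)
    ≡⟨ sumTo-suc-head N _ ⟨
  sumTo (suc N) (λ j → + (0 C j) * W (d ℕ.+ j) 0) ∎
  where open ≡-Reasoning
binomial-of-pascal W W-suc (suc k) d (suc N) (s≤s k<N) = begin
  W d (suc k)
    ≡⟨ W-suc d k ⟩
  W d k + W (suc d) k
    ≡⟨ cong₂ _+_ (binomial-of-pascal W W-suc k d (suc N) (ℕ.m<n⇒m<1+n k<N))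
                 (binomial-of-pascal W W-suc k (suc d) N k<N) ⟩
  sumTo (suc N) (λ j → + (k C j) * W (d ℕ.+ j) 0) + sumTo N (λ j → + (k C j) * W (suc d ℕ.+ j) 0)
    ≡⟨ cong (λ z → sumTo (suc N) (λ j → + (k C j) * W (d ℕ.+ j) 0) + z)
            (sumTo-cong N (λ j _ → cong (λ z → + (k C j) * W z 0) (sym (ℕ.+-suc d j)))) ⟩
  sumTo (suc N) (λ j → + (k C j) * W (d ℕ.+ j) 0) + sumTo N (λ j → + (k C j) * W (d ℕ.+ suc j) 0)
    ≡⟨ sumTo-pascal k N (λ j → W (d ℕ.+ j) 0) ⟨
  sumTo (suc N) (λ j → + (suc k C j) * W (d ℕ.+ j) 0) ∎
  where open ≡-Reasoning

-- Powers of 1 - t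

-- difference and partialSums are multiplication by 1 - t and by 1 / (1 - t).
difference : Series → Series
difference s zero    = s zero
difference s (suc m) = s (suc m) - s m

partialSums : Series → Series
partialSums s m = sumTo (suc m) s

partialSums-cong : ∀ {s t} → s ≗ t → partialSums s ≗ partialSums t
partialSums-cong s≗t m = sumTo-cong (suc m) (λ i _ → s≗t i)

partialSums-difference : ∀ s → partialSums (difference s) ≗ s
partialSums-difference s zero    = ℤ.+-identityˡ (s 0)
partialSums-difference s (suc m) =
  trans (cong (_+ (s (suc m) - s m)) (partialSums-difference s m))
    (solve 2 (λ a b → a :+ (b :- a) := b) refl (s m) (s (suc m)))

mulOneMinusTPow-zero : ∀ s → mulOneMinusTPow 0 s ≗ s
mulOneMinusTPow-zero s m = begin
  mulOneMinusTPow 0 s m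
    ≡⟨ sumTo-suc-head m _ ⟩
  + 1 * + 1 * s m + sumTo m (λ j → sign (suc j) * + 0 * s (m ∸ suc j))
    ≡⟨ cong₂ _+_ (solve 1 (λ x → con (+ 1) :* con (+ 1) :* x := x) refl (s m))
                 (sumTo-zero m (λ j → solve 2 (λ g x → g :* con (+ 0) :* x := con (+ 0)) refl
                                         (sign (suc j)) (s (m ∸ suc j)))) ⟩
  s m + + 0
    ≡⟨ ℤ.+-identityʳ (s m) ⟩
  s m ∎
  where open ≡-Reasoning

mulOneMinusTPow-suc : ∀ N s → mulOneMinusTPow (suc N) s ≗ difference (mulOneMinusTPow N s)
mulOneMinusTPow-suc N s zero    = refl
mulOneMinusTPow-suc N s (suc m) = begin
  mulOneMinusTPow (suc N) s (suc m)
    ≡⟨ sumTo-suc-head (suc m) _ ⟩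
  s₀ + sumTo (suc m) (λ j → sign (suc j) * + (suc N C suc j) * s (m ∸ j))
    ≡⟨ cong (λ z → s₀ + z) (trans (sumTo-cong (suc m) (λ j _ → split j)) (sumTo-+ (suc m) t₁ t₂)) ⟩
  s₀ + (sumTo (suc m) t₁ + sumTo (suc m) t₂)
    ≡⟨ cong (λ z → s₀ + (sumTo (suc m) t₁ + z)) (sumTo-neg (suc m) _) ⟩
  s₀ + (sumTo (suc m) t₁ - mulOneMinusTPow N s m)
    ≡⟨ sym (ℤ.+-assoc s₀ _ _) ⟩
  (s₀ + sumTo (suc m) t₁) - mulOneMinusTPow N s m
    ≡⟨ cong (_- mulOneMinusTPow N s m) (sym (sumTo-suc-head (suc m) _)) ⟩
  mulOneMinusTPow N s (suc m) - mulOneMinusTPow N s m ∎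
  where
  open ≡-Reasoning
  s₀ = + 1 * + 1 * s (suc m)
  t₁ t₂ : ℕ → ℤ
  t₁ j = sign (suc j) * + (N C suc j) * s (m ∸ j)
  t₂ j = - (sign j * + (N C j) * s (m ∸ j))
  split : ∀ j → sign (suc j) * + (suc N C suc j) * s (m ∸ j) ≡ t₁ j + t₂ j
  split j = trans (cong (λ c → sign (suc j) * c * s (m ∸ j)) (pascal N j))
    (solve 4 (λ g a b x → (:- g) :* (a :+ b) :* x := (:- g) :* b :* x :+ (:- (g :* a :* x))) refl
      (sign j) (+ (N C j)) (+ (N C suc j)) (s (m ∸ j)))

divOneMinusTPowSuc-cong : ∀ n {s t} → s ≗ t → divOneMinusTPowSuc n s ≗ divOneMinusTPowSuc n t
divOneMinusTPowSuc-cong n s≗t m = sumTo-cong (suc m) (λ i _ → cong (_* + ((m ∸ i ℕ.+ n) C n)) (s≗t i))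

divOneMinusTPowSuc-zero : ∀ s → divOneMinusTPowSuc 0 s ≗ partialSums s
divOneMinusTPowSuc-zero s m = sumTo-cong (suc m) (λ i _ → ℤ.*-identityʳ (s i))

-- Pascal's rule C(m - i + n + 2, n + 1) = C(m - i + n + 1, n + 1) + C(m - i + n + 1, n) in each term.
divOneMinusTPowSuc-suc-step : ∀ n s m →
  divOneMinusTPowSuc (suc n) s (suc m) ≡ divOneMinusTPowSuc (suc n) s m + divOneMinusTPowSuc n s (suc m)
divOneMinusTPowSuc-suc-step n s m = begin
  sumTo (suc m) (λ i → s i * + ((suc m ∸ i ℕ.+ suc n) C suc n))
    + s (suc m) * + ((suc m ∸ suc m ℕ.+ suc n) C suc n)
    ≡⟨ cong₂ _+_ (trans (sumTo-cong (suc m) split) (sumTo-+ (suc m) X Y))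
                 (cong (λ z → s (suc m) * + z) (last (suc n))) ⟩
  (sumTo (suc m) X + sumTo (suc m) Y) + s (suc m) * + 1
    ≡⟨ ℤ.+-assoc (sumTo (suc m) X) _ _ ⟩
  sumTo (suc m) X + (sumTo (suc m) Y + s (suc m) * + 1)
    ≡⟨ cong (λ z → sumTo (suc m) X + (sumTo (suc m) Y + s (suc m) * + z)) (sym (last n)) ⟩
  sumTo (suc m) X + (sumTo (suc m) Y + s (suc m) * + ((suc m ∸ suc m ℕ.+ n) C n)) ∎
  where
  open ≡-Reasoning
  X Y : ℕ → ℤ
  X i = s i * + ((m ∸ i ℕ.+ suc n) C suc n)
  Y i = s i * + ((suc m ∸ i ℕ.+ n) C n)
  last : ∀ k → (suc m ∸ suc m ℕ.+ k) C k ≡ 1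
  last k = trans (cong (λ z → (z ℕ.+ k) C k) (ℕ.n∸n≡0 m)) (nCn≡1 k)
  split : ∀ i → i < suc m → s i * + ((suc m ∸ i ℕ.+ suc n) C suc n) ≡ X i + Y i
  split i (s≤s i≤m) = begin
    s i * + ((suc m ∸ i ℕ.+ suc n) C suc n)
      ≡⟨ cong (λ z → s i * + ((z ℕ.+ suc n) C suc n)) (ℕ.+-∸-assoc 1 i≤m) ⟩
    s i * + (suc (m ∸ i ℕ.+ suc n) C suc n)
      ≡⟨ cong (s i *_) (pascal (m ∸ i ℕ.+ suc n) n) ⟩
    s i * (+ ((m ∸ i ℕ.+ suc n) C n) + + ((m ∸ i ℕ.+ suc n) C suc n))
      ≡⟨ solve 3 (λ x p q → x :* (p :+ q) := x :* q :+ x :* p) refl (s i) _ _ ⟩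
    X i + s i * + ((m ∸ i ℕ.+ suc n) C n)
      ≡⟨ cong (λ z → X i + s i * + (z C n)) (trans (ℕ.+-suc (m ∸ i) n)
                                                   (cong (ℕ._+ n) (sym (ℕ.+-∸-assoc 1 i≤m)))) ⟩
    X i + Y i ∎

divOneMinusTPowSuc-suc : ∀ n s → divOneMinusTPowSuc (suc n) s ≗ partialSums (divOneMinusTPowSuc n s)
divOneMinusTPowSuc-suc n s zero = begin
  + 0 + s 0 * + (suc n C suc n)   ≡⟨ cong (λ z → + 0 + s 0 * + z) (nCn≡1 (suc n)) ⟩
  + 0 + s 0 * + 1                 ≡⟨ sym (ℤ.+-identityˡ _) ⟩
  + 0 + (+ 0 + s 0 * + 1)         ≡⟨ cong (λ z → + 0 + (+ 0 + s 0 * + z)) (sym (nCn≡1 n)) ⟩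
  + 0 + (+ 0 + s 0 * + (n C n))   ∎
  where open ≡-Reasoning
divOneMinusTPowSuc-suc n s (suc m) =
  trans (divOneMinusTPowSuc-suc-step n s m)
        (cong (_+ divOneMinusTPowSuc n s (suc m)) (divOneMinusTPowSuc-suc n s m))

divOneMinusTPowSuc-difference : ∀ n s →
  divOneMinusTPowSuc (suc n) (difference s) ≗ divOneMinusTPowSuc n s
divOneMinusTPowSuc-difference zero s m = begin
  divOneMinusTPowSuc 1 (difference s) m
    ≡⟨ divOneMinusTPowSuc-suc 0 (difference s) m ⟩
  partialSums (divOneMinusTPowSuc 0 (difference s)) m
    ≡⟨ partialSums-cong (divOneMinusTPowSuc-zero _) m ⟩
  partialSums (partialSums (difference s)) m
    ≡⟨ partialSums-cong (partialSums-difference s) m ⟩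
  partialSums s m
    ≡⟨ divOneMinusTPowSuc-zero s m ⟨
  divOneMinusTPowSuc 0 s m ∎
  where open ≡-Reasoning
divOneMinusTPowSuc-difference (suc n) s m = begin
  divOneMinusTPowSuc (suc (suc n)) (difference s) m
    ≡⟨ divOneMinusTPowSuc-suc (suc n) (difference s) m ⟩
  partialSums (divOneMinusTPowSuc (suc n) (difference s)) m
    ≡⟨ partialSums-cong (divOneMinusTPowSuc-difference n s) m ⟩
  partialSums (divOneMinusTPowSuc n s) m
    ≡⟨ divOneMinusTPowSuc-suc n s m ⟨
  divOneMinusTPowSuc (suc n) s m ∎
  where open ≡-Reasoning

divOneMinusTPowSuc-mulOneMinusTPow : ∀ n s → divOneMinusTPowSuc n (mulOneMinusTPow (suc n) s) ≗ s
divOneMinusTPowSuc-mulOneMinusTPow zero s m = begin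
  divOneMinusTPowSuc 0 (mulOneMinusTPow 1 s) m
    ≡⟨ divOneMinusTPowSuc-cong 0 (mulOneMinusTPow-suc 0 s) m ⟩
  divOneMinusTPowSuc 0 (difference (mulOneMinusTPow 0 s)) m
    ≡⟨ divOneMinusTPowSuc-zero _ m ⟩
  partialSums (difference (mulOneMinusTPow 0 s)) m
    ≡⟨ partialSums-difference _ m ⟩
  mulOneMinusTPow 0 s m
    ≡⟨ mulOneMinusTPow-zero s m ⟩
  s m ∎
  where open ≡-Reasoning
divOneMinusTPowSuc-mulOneMinusTPow (suc n) s m = begin
  divOneMinusTPowSuc (suc n) (mulOneMinusTPow (suc (suc n)) s) m
    ≡⟨ divOneMinusTPowSuc-cong (suc n) (mulOneMinusTPow-suc (suc n) s) m ⟩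
  divOneMinusTPowSuc (suc n) (difference (mulOneMinusTPow (suc n) s)) m
    ≡⟨ divOneMinusTPowSuc-difference n _ m ⟩
  divOneMinusTPowSuc n (mulOneMinusTPow (suc n) s) m
    ≡⟨ divOneMinusTPowSuc-mulOneMinusTPow n s m ⟩
  s m ∎
  where open ≡-Reasoning

countB-cong : ∀ {p q : A → Bool} → (∀ x → p x ≡ q x) → (xs : List A) → countB p xs ≡ countB q xs
countB-cong p≡q []       = refl
countB-cong p≡q (x ∷ xs) rewrite p≡q x = cong (λ c → if _ then suc c else c) (countB-cong p≡q xs)

countB-none : ∀ {p : A → Bool} → (∀ x → p x ≡ false) → (xs : List A) → countB p xs ≡ 0
countB-none p≡false []       = refl
countB-none p≡false (x ∷ xs) rewrite p≡false x = countB-none p≡false xs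

countB-map : (p : B → Bool) (f : A → B) (xs : List A) → countB p (map f xs) ≡ countB (p ∘ f) xs
countB-map p f []       = refl
countB-map p f (x ∷ xs) with p (f x)
... | true  = cong suc (countB-map p f xs)
... | false = countB-map p f xs

countB-filterᵇ : (p q : A → Bool) (xs : List A) → countB p (filterᵇ q xs) ≡ countB (λ x → q x ∧ p x) xs
countB-filterᵇ p q []       = refl
countB-filterᵇ p q (x ∷ xs) with q x
... | false = countB-filterᵇ p q xs
... | true with p x
...   | true  = cong suc (countB-filterᵇ p q xs)
...   | false = countB-filterᵇ p q xs

countB-split : (q p : A → Bool) (xs : List A) →
  countB p xs ≡ countB (λ x → not (q x) ∧ p x) xs ℕ.+ countB (λ x → q x ∧ p x) xs
countB-split q p []       = refl
countB-split q p (x ∷ xs) with q x | p x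
... | false | false = countB-split q p xs
... | true  | false = countB-split q p xs
... | false | true  = cong suc (countB-split q p xs)
... | true  | true  = trans (cong suc (countB-split q p xs)) (sym (ℕ.+-suc _ _))

countB-+-countB-not : (p : A → Bool) (xs : List A) → countB p xs ℕ.+ countB (not ∘ p) xs ≡ length xs
countB-+-countB-not p []       = refl
countB-+-countB-not p (x ∷ xs) with p x
... | true  = cong suc (countB-+-countB-not p xs)
... | false = trans (ℕ.+-suc _ _) (cong suc (countB-+-countB-not p xs))

filterᵇ-concatMap : (q : B → Bool) (f : A → List B) (xs : List A) →
  filterᵇ q (concatMap f xs) ≡ concatMap (filterᵇ q ∘ f) xs
filterᵇ-concatMap q f []       = refl
filterᵇ-concatMap q f (x ∷ xs) =
  trans (List.filter-++ _ (f x) (concatMap f xs)) (cong (filterᵇ q (f x) ++_) (filterᵇ-concatMap q f xs))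

concatMap-filterᵇ : (f : A → List B) (q : A → Bool) (xs : List A) →
  concatMap f (filterᵇ q xs) ≡ concatMap (λ x → if q x then f x else []) xs
concatMap-filterᵇ f q []       = refl
concatMap-filterᵇ f q (x ∷ xs) with q x
... | true  = cong (f x ++_) (concatMap-filterᵇ f q xs)
... | false = concatMap-filterᵇ f q xs

length-concatMap-const : ∀ (f : A → List B) {m} → (∀ x → length (f x) ≡ m) → (xs : List A) →
  length (concatMap f xs) ≡ length xs ℕ.* m
length-concatMap-const f |f|≡m []       = refl
length-concatMap-const f |f|≡m (x ∷ xs) =
  trans (List.length-++ (f x)) (cong₂ ℕ._+_ (|f|≡m x) (length-concatMap-const f |f|≡m xs))

all-∷ʳ : (f : A → Bool) (xs : List A) (x : A) → all f (xs ∷ʳ x) ≡ all f xs ∧ f x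
all-∷ʳ f []       x = ∧-identityʳ (f x)
all-∷ʳ f (y ∷ xs) x = trans (cong (f y ∧_) (all-∷ʳ f xs x)) (sym (∧-assoc (f y) _ _))

all-upTo-suc : ∀ (f : ℕ → Bool) d → all f (upTo (suc d)) ≡ all f (upTo d) ∧ f d
all-upTo-suc f d = trans (cong (all f) (sym (List.upTo-∷ʳ d))) (all-∷ʳ f (upTo d) d)

all-upTo-cong : ∀ d {f g : ℕ → Bool} → (∀ j → j < d → f j ≡ g j) → all f (upTo d) ≡ all g (upTo d)
all-upTo-cong zero    f≡g = refl
all-upTo-cong (suc d) {f} {g} f≡g = begin
  all f (upTo (suc d))    ≡⟨ all-upTo-suc f d ⟩
  all f (upTo d) ∧ f d    ≡⟨ cong₂ _∧_ (all-upTo-cong d (λ j j<d → f≡g j (ℕ.m<n⇒m<1+n j<d)))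
                                       (f≡g d ℕ.≤-refl) ⟩
  all g (upTo d) ∧ g d    ≡⟨ all-upTo-suc g d ⟨
  all g (upTo (suc d))    ∎
  where open ≡-Reasoning

values : ℕ → List ℕ
values k = map suc (upTo k)

-- L^n, enumerated in the same order as cube
cubeOver : (n : ℕ) → List ℕ → List (Vec ℕ n)
cubeOver zero    L = Vec.[] ∷ []
cubeOver (suc n) L = concatMap (λ v → map (_∷ v) L) (cubeOver n L)

allOf : ∀ {n} → (ℕ → Bool) → Vec ℕ n → Bool
allOf p c = all p (toList c)

cube≡cubeOver : ∀ n k → cube n k ≡ cubeOver n (values k)
cube≡cubeOver zero    k = refl
cube≡cubeOver (suc n) k = trans
  (List.concatMap-cong (λ v → List.map-∘ (upTo k)) (cube n k))
  (cong (concatMap (λ v → map (_∷ v) (values k))) (cube≡cubeOver n k))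

cubeOver-map : ∀ n (g : ℕ → ℕ) L → cubeOver n (map g L) ≡ map (Vec.map g) (cubeOver n L)
cubeOver-map zero    g L = refl
cubeOver-map (suc n) g L = begin
  concatMap (λ v → map (_∷ v) (map g L)) (cubeOver n (map g L))
    ≡⟨ cong (concatMap _) (cubeOver-map n g L) ⟩
  concatMap (λ v → map (_∷ v) (map g L)) (map (Vec.map g) (cubeOver n L))
    ≡⟨ List.concatMap-map _ (Vec.map g) (cubeOver n L) ⟩
  concatMap (λ v → map (_∷ Vec.map g v) (map g L)) (cubeOver n L)
    ≡⟨ List.concatMap-cong (λ v → trans (sym (List.map-∘ L)) (List.map-∘ L)) (cubeOver n L) ⟩
  concatMap (λ v → map (Vec.map g) (map (_∷ v) L)) (cubeOver n L)
    ≡⟨ List.map-concatMap (Vec.map g) _ (cubeOver n L) ⟨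
  map (Vec.map g) (concatMap (λ v → map (_∷ v) L) (cubeOver n L)) ∎
  where open ≡-Reasoning

filterᵇ-allOf-map-∷ : ∀ {n} (p : ℕ → Bool) (v : Vec ℕ n) L →
  filterᵇ (allOf p) (map (_∷ v) L) ≡ (if allOf p v then map (_∷ v) (filterᵇ p L) else [])
filterᵇ-allOf-map-∷ p v L with allOf p v in pv
... | true  = go L
  where
  go : ∀ L → filterᵇ (allOf p) (map (_∷ v) L) ≡ map (_∷ v) (filterᵇ p L)
  go []      = refl
  go (x ∷ L) rewrite pv with p x
  ... | true  = cong ((x ∷ v) ∷_) (go L)
  ... | false = go L
... | false = go L
  where
  go : ∀ L → filterᵇ (allOf p) (map (_∷ v) L) ≡ []
  go []      = refl
  go (x ∷ L) rewrite pv | ∧-zeroʳ (p x) = go L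

cubeOver-filterᵇ : ∀ n (p : ℕ → Bool) L → cubeOver n (filterᵇ p L) ≡ filterᵇ (allOf p) (cubeOver n L)
cubeOver-filterᵇ zero    p L = refl
cubeOver-filterᵇ (suc n) p L = begin
  concatMap (λ v → map (_∷ v) (filterᵇ p L)) (cubeOver n (filterᵇ p L))
    ≡⟨ cong (concatMap _) (cubeOver-filterᵇ n p L) ⟩
  concatMap (λ v → map (_∷ v) (filterᵇ p L)) (filterᵇ (allOf p) (cubeOver n L))
    ≡⟨ concatMap-filterᵇ _ (allOf p) (cubeOver n L) ⟩
  concatMap (λ v → if allOf p v then map (_∷ v) (filterᵇ p L) else []) (cubeOver n L)
    ≡⟨ List.concatMap-cong (λ v → filterᵇ-allOf-map-∷ p v L) (cubeOver n L) ⟨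
  concatMap (λ v → filterᵇ (allOf p) (map (_∷ v) L)) (cubeOver n L)
    ≡⟨ filterᵇ-concatMap (allOf p) _ (cubeOver n L) ⟨
  filterᵇ (allOf p) (concatMap (λ v → map (_∷ v) L) (cubeOver n L)) ∎
  where open ≡-Reasoning

length-cube : ∀ n k → length (cube n k) ≡ k ^ n
length-cube zero    k = refl
length-cube (suc n) k = begin
  length (cube (suc n) k)
    ≡⟨ length-concatMap-const _ (λ v → trans (List.length-map _ (upTo k)) (List.length-upTo k)) (cube n k) ⟩
  length (cube n k) ℕ.* k ≡⟨ cong (ℕ._* k) (length-cube n k) ⟩
  k ^ n ℕ.* k             ≡⟨ ℕ.*-comm (k ^ n) k ⟩
  k ^ suc n               ∎
  where open ≡-Reasoning

cube-suc-zero : ∀ n → cube (suc n) 0 ≡ []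
cube-suc-zero n = concatMap-[] (cube n 0)
  where
  concatMap-[] : (xs : List (Vec ℕ n)) → concatMap (λ _ → []) xs ≡ [] {A = Vec ℕ (suc n)}
  concatMap-[] []       = refl
  concatMap-[] (_ ∷ xs) = concatMap-[] xs

-- Order invariance

≡ᵇ-reflects-≡ : ∀ m n → Reflects (m ≡ n) (m ≡ᵇ n)
≡ᵇ-reflects-≡ m n = fromEquivalence (ℕ.≡ᵇ⇒≡ m n) (ℕ.≡⇒≡ᵇ m n)

≡ᵇ-false : ∀ {m n} → m ≢ n → (m ≡ᵇ n) ≡ false
≡ᵇ-false {m} {n} m≢n = det (≡ᵇ-reflects-≡ m n) (ofⁿ m≢n)

≤ᵇ-true : ∀ {m n} → m ≤ n → (m ≤ᵇ n) ≡ true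
≤ᵇ-true {m} {n} m≤n = det (ℕ.≤ᵇ-reflects-≤ m n) (ofʸ m≤n)

≤ᵇ-false : ∀ {m n} → n < m → (m ≤ᵇ n) ≡ false
≤ᵇ-false {m} {n} n<m = det (ℕ.≤ᵇ-reflects-≤ m n) (ofⁿ (ℕ.<⇒≱ n<m))

≤ᵇ-preserved : ∀ {h} → h Preserves _<_ ⟶ _<_ → ∀ x y → (h x ≤ᵇ h y) ≡ (x ≤ᵇ y)
≤ᵇ-preserved {h} h-mono x y = det (ℕ.≤ᵇ-reflects-≤ (h x) (h y)) (fromEquivalence sound complete)
  where
  sound : T (x ≤ᵇ y) → h x ≤ h y
  sound x≤y with ℕ.m≤n⇒m<n∨m≡n (ℕ.≤ᵇ⇒≤ x y x≤y)
  ... | inj₁ x<y  = ℕ.<⇒≤ (h-mono x<y)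
  ... | inj₂ refl = ℕ.≤-refl
  complete : h x ≤ h y → T (x ≤ᵇ y)
  complete hx≤hy = ℕ.≤⇒≤ᵇ (ℕ.≮⇒≥ (λ y<x → ℕ.<⇒≱ (h-mono y<x) hx≤hy))

-- K depends only on the relative order of the coordinates, i.e. on Δ(c).
OrderInvariant : ∀ {n} → Config n → Set
OrderInvariant {n} K = ∀ {h} → h Preserves _<_ ⟶ _<_ → (c : Vec ℕ n) → K (Vec.map h c) ≡ K c

eval-orderInvariant : ∀ {n} (S : Formula n) → OrderInvariant (eval S)
eval-orderInvariant (atom i j) {h} h-mono c =
  trans (cong₂ _≤ᵇ_ (Vec.lookup-map i h c) (Vec.lookup-map j h c)) (≤ᵇ-preserved h-mono _ _)
eval-orderInvariant ⊤f       h-mono c = refl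
eval-orderInvariant ⊥f       h-mono c = refl
eval-orderInvariant (¬f S)   h-mono c = cong not (eval-orderInvariant S h-mono c)
eval-orderInvariant (S ∧f T) h-mono c =
  cong₂ _∧_ (eval-orderInvariant S h-mono c) (eval-orderInvariant T h-mono c)
eval-orderInvariant (S ∨f T) h-mono c =
  cong₂ _∨_ (eval-orderInvariant S h-mono c) (eval-orderInvariant T h-mono c)
eval-orderInvariant (S ⇒f T) h-mono c =
  cong₂ (λ a b → not a ∨ b) (eval-orderInvariant S h-mono c) (eval-orderInvariant T h-mono c)
eval-orderInvariant (S ⇔f T) h-mono c =
  cong₂ (λ a b → (a ∧ b) ∨ (not a ∧ not b))
        (eval-orderInvariant S h-mono c) (eval-orderInvariant T h-mono c)

-- Opens a gap at the value d + 1.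
shiftAbove : ℕ → ℕ → ℕ
shiftAbove d x = if x ≤ᵇ d then x else suc x

shiftAbove-≤ : ∀ {d x} → x ≤ d → shiftAbove d x ≡ x
shiftAbove-≤ x≤d rewrite ≤ᵇ-true x≤d = refl

shiftAbove-> : ∀ {d x} → d < x → shiftAbove d x ≡ suc x
shiftAbove-> d<x rewrite ≤ᵇ-false d<x = refl

shiftAbove-mono : ∀ d → shiftAbove d Preserves _<_ ⟶ _<_
shiftAbove-mono d {x} {y} x<y with x ℕ.≤? d | y ℕ.≤? d
... | yes x≤d | yes y≤d rewrite shiftAbove-≤ x≤d | shiftAbove-≤ y≤d = x<y
... | yes x≤d | no  y≰d rewrite shiftAbove-≤ x≤d | shiftAbove-> (ℕ.≰⇒> y≰d) = ℕ.m<n⇒m<1+n x<y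
... | no  x≰d | yes y≤d = ⊥-elim (ℕ.<-asym (ℕ.≰⇒> x≰d) (ℕ.<-≤-trans x<y y≤d))
... | no  x≰d | no  y≰d rewrite shiftAbove-> (ℕ.≰⇒> x≰d) | shiftAbove-> (ℕ.≰⇒> y≰d) = s≤s x<y

hits : ∀ {n} → ℕ → Vec ℕ n → Bool
hits v c = any (λ x → x ≡ᵇ v) (toList c)

hits⇒lookup : ∀ {n} v (c : Vec ℕ n) → T (hits v c) → ∃[ i ] lookup c i ≡ v
hits⇒lookup v (x ∷ c) x∈c with x ≡ᵇ v in x≡ᵇv
... | true  = Fin.zero , ℕ.≡ᵇ⇒≡ x v (subst T (sym x≡ᵇv) tt)
... | false = let i , cᵢ≡v = hits⇒lookup v c x∈c in Fin.suc i , cᵢ≡v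

hits-map : ∀ {n} {h : ℕ → ℕ} {v} → (∀ x → (h x ≡ᵇ v) ≡ (x ≡ᵇ v)) → (c : Vec ℕ n) →
  hits v (Vec.map h c) ≡ hits v c
hits-map {h = h} {v} hx≡ᵇv c = cong or (begin
  map (_≡ᵇ v) (toList (Vec.map h c))  ≡⟨ cong (map (_≡ᵇ v)) (Vec.toList-map h c) ⟩
  map (_≡ᵇ v) (map h (toList c))      ≡⟨ List.map-∘ (toList c) ⟨
  map ((_≡ᵇ v) ∘ h) (toList c)        ≡⟨ List.map-cong hx≡ᵇv (toList c) ⟩
  map (_≡ᵇ v) (toList c)              ∎)
  where open ≡-Reasoning

not-hits : ∀ {n} v (c : Vec ℕ n) → not (hits v c) ≡ allOf (λ x → not (x ≡ᵇ v)) c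
not-hits v Vec.[]  = refl
not-hits v (x ∷ c) with x ≡ᵇ v
... | true  = refl
... | false = not-hits v c

isSurj-suc : ∀ {n} d (c : Vec ℕ n) → isSurj (suc d) c ≡ isSurj d c ∧ hits (suc d) c
isSurj-suc d c = all-upTo-suc (λ j → hits (suc j) c) d

isSurj-shiftAbove : ∀ {n} d (c : Vec ℕ n) → isSurj d (Vec.map (shiftAbove d) c) ≡ isSurj d c
isSurj-shiftAbove d c = all-upTo-cong d (λ j j<d → hits-map (shiftAbove-≡ᵇ j<d) c)
  where
  shiftAbove-≡ᵇ : ∀ {j} → j < d → ∀ x → (shiftAbove d x ≡ᵇ suc j) ≡ (x ≡ᵇ suc j)
  shiftAbove-≡ᵇ j<d x with x ℕ.≤? d
  ... | yes x≤d rewrite shiftAbove-≤ x≤d = refl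
  ... | no  x≰d rewrite shiftAbove-> (ℕ.≰⇒> x≰d) =
    trans (≡ᵇ-false (λ x+1≡j+1 → ℕ.<⇒≢ (ℕ.<-trans j<d d<x) (sym (ℕ.suc-injective x+1≡j+1))))
          (sym (≡ᵇ-false (λ x≡j+1 → ℕ.<⇒≢ (ℕ.≤-<-trans j<d d<x) (sym x≡j+1))))
    where d<x = ℕ.≰⇒> x≰d

-- Pigeonhole: distinct values 1, …, d occupy distinct positions of c.
isSurj⇒≤ : ∀ {n} d (c : Vec ℕ n) → T (isSurj d c) → d ≤ n
isSurj⇒≤ {n} d c surj = Fin.injective⇒≤ {f = position} position-injective
  where
  hit : (i : Fin d) → ∃[ p ] lookup c p ≡ suc (toℕ i)
  hit i = hits⇒lookup _ c (All.lookup (all⁺ _ (upTo d) surj) (∈-upTo⁺ (Fin.toℕ<n i)))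
  position : Fin d → Fin n
  position = proj₁ ∘ hit
  position-injective : ∀ {i j} → position i ≡ position j → i ≡ j
  position-injective {i} {j} eq = Fin.toℕ-injective (ℕ.suc-injective
    (trans (sym (proj₂ (hit i))) (trans (cong (lookup c) eq) (proj₂ (hit j)))))

fvec-beyond≡0 : ∀ {n} (K : Config n) j → n < j → fvec K j ≡ 0
fvec-beyond≡0 {n} K j n<j = countB-none not-surj (cube n j)
  where
  not-surj : ∀ c → isSurj j c ∧ K c ≡ false
  not-surj c with isSurj j c in surj
  ... | true  = ⊥-elim (ℕ.<⇒≱ n<j (isSurj⇒≤ j c (subst T (sym surj) tt)))
  ... | false = refl

fvec-0≡0 : ∀ {n} (K : Config n) → 1 ≤ n → fvec K 0 ≡ 0
fvec-0≡0 {suc n} K _ = cong (countB _) (cube-suc-zero n)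

-- Squeezing out the value d + 1

avoids : ℕ → ℕ → Bool
avoids d x = not (x ≡ᵇ suc d)

values-suc : ∀ m → values (suc m) ≡ values m ∷ʳ suc m
values-suc m = trans (cong (map suc) (sym (List.upTo-∷ʳ m))) (List.map-++ suc (upTo m) [ m ])

filterᵇ-avoids-≢ : ∀ {d x} → x ≢ suc d → filterᵇ (avoids d) [ x ] ≡ [ x ]
filterᵇ-avoids-≢ {d} {x} x≢d+1 =
  List.filter-accept (T? ∘ avoids d) {x} {[]} (Equivalence.from T-not-≡ (≡ᵇ-false x≢d+1))

filterᵇ-avoids-≡ : ∀ d → filterᵇ (avoids d) [ suc d ] ≡ []
filterᵇ-avoids-≡ d = List.filter-reject (T? ∘ avoids d) {suc d} {[]}
  (λ t → subst T (Equivalence.to T-not-≡ t) (ℕ.≡⇒≡ᵇ (suc d) (suc d) refl))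

filterᵇ-values-suc : ∀ (p : ℕ → Bool) m →
  filterᵇ p (values (suc m)) ≡ filterᵇ p (values m) ++ filterᵇ p [ suc m ]
filterᵇ-values-suc p m =
  trans (cong (filterᵇ p) (values-suc m)) (List.filter-++ (T? ∘ p) (values m) [ suc m ])

map-values-suc : ∀ (h : ℕ → ℕ) m → map h (values (suc m)) ≡ map h (values m) ∷ʳ h (suc m)
map-values-suc h m = trans (cong (map h) (values-suc m)) (List.map-++ h (values m) [ suc m ])

filterᵇ-avoids-values-≤ : ∀ d m → m ≤ d →
  filterᵇ (avoids d) (values m) ≡ map (shiftAbove d) (values m)
filterᵇ-avoids-values-≤ d zero    _   = refl
filterᵇ-avoids-values-≤ d (suc m) m<d = begin
  filterᵇ (avoids d) (values (suc m))
    ≡⟨ filterᵇ-values-suc (avoids d) m ⟩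
  filterᵇ (avoids d) (values m) ++ filterᵇ (avoids d) [ suc m ]
    ≡⟨ cong₂ _++_ (filterᵇ-avoids-values-≤ d m (ℕ.<⇒≤ m<d))
                  (filterᵇ-avoids-≢ (λ m+1≡d+1 → ℕ.<⇒≢ m<d (ℕ.suc-injective m+1≡d+1))) ⟩
  map (shiftAbove d) (values m) ∷ʳ suc m
    ≡⟨ cong (map (shiftAbove d) (values m) ∷ʳ_) (shiftAbove-≤ m<d) ⟨
  map (shiftAbove d) (values m) ∷ʳ shiftAbove d (suc m)
    ≡⟨ map-values-suc (shiftAbove d) m ⟨
  map (shiftAbove d) (values (suc m)) ∎
  where open ≡-Reasoning

filterᵇ-avoids-values : ∀ d k →
  filterᵇ (avoids d) (values (suc (d ℕ.+ k))) ≡ map (shiftAbove d) (values (d ℕ.+ k))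
filterᵇ-avoids-values d zero rewrite ℕ.+-identityʳ d = begin
  filterᵇ (avoids d) (values (suc d))
    ≡⟨ filterᵇ-values-suc (avoids d) d ⟩
  filterᵇ (avoids d) (values d) ++ filterᵇ (avoids d) [ suc d ]
    ≡⟨ cong₂ _++_ (filterᵇ-avoids-values-≤ d d ℕ.≤-refl) (filterᵇ-avoids-≡ d) ⟩
  map (shiftAbove d) (values d) ++ []
    ≡⟨ List.++-identityʳ (map (shiftAbove d) (values d)) ⟩
  map (shiftAbove d) (values d) ∎
  where open ≡-Reasoning
filterᵇ-avoids-values d (suc k) rewrite ℕ.+-suc d k = begin
  filterᵇ (avoids d) (values (suc (suc (d ℕ.+ k))))
    ≡⟨ filterᵇ-values-suc (avoids d) (suc (d ℕ.+ k)) ⟩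
  filterᵇ (avoids d) (values (suc (d ℕ.+ k))) ++ filterᵇ (avoids d) [ suc (suc (d ℕ.+ k)) ]
    ≡⟨ cong₂ _++_ (filterᵇ-avoids-values d k)
                  (filterᵇ-avoids-≢ (λ e → ℕ.<⇒≢ d<d+k+1 (sym (ℕ.suc-injective e)))) ⟩
  map (shiftAbove d) (values (d ℕ.+ k)) ∷ʳ suc (suc (d ℕ.+ k))
    ≡⟨ cong (map (shiftAbove d) (values (d ℕ.+ k)) ∷ʳ_) (shiftAbove-> d<d+k+1) ⟨
  map (shiftAbove d) (values (d ℕ.+ k)) ∷ʳ shiftAbove d (suc (d ℕ.+ k))
    ≡⟨ map-values-suc (shiftAbove d) (d ℕ.+ k) ⟨
  map (shiftAbove d) (values (suc (d ℕ.+ k))) ∎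
  where
  open ≡-Reasoning
  d<d+k+1 : d < suc (d ℕ.+ k)
  d<d+k+1 = s≤s (ℕ.m≤m+n d k)

countB-avoiding : ∀ {n} d k (P : Vec ℕ n → Bool) → (∀ c → P (Vec.map (shiftAbove d) c) ≡ P c) →
  countB (λ c → not (hits (suc d) c) ∧ P c) (cube n (suc (d ℕ.+ k))) ≡ countB P (cube n (d ℕ.+ k))
countB-avoiding {n} d k P P-inv = begin
  countB (λ c → not (hits (suc d) c) ∧ P c) (cube n (suc M))
    ≡⟨ countB-cong (λ c → cong (_∧ P c) (not-hits (suc d) c)) (cube n (suc M)) ⟩
  countB (λ c → allOf (avoids d) c ∧ P c) (cube n (suc M))
    ≡⟨ cong (countB _) (cube≡cubeOver n (suc M)) ⟩
  countB (λ c → allOf (avoids d) c ∧ P c) (cubeOver n (values (suc M)))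
    ≡⟨ countB-filterᵇ P (allOf (avoids d)) (cubeOver n (values (suc M))) ⟨
  countB P (filterᵇ (allOf (avoids d)) (cubeOver n (values (suc M))))
    ≡⟨ cong (countB P) (cubeOver-filterᵇ n (avoids d) (values (suc M))) ⟨
  countB P (cubeOver n (filterᵇ (avoids d) (values (suc M))))
    ≡⟨ cong (countB P ∘ cubeOver n) (filterᵇ-avoids-values d k) ⟩
  countB P (cubeOver n (map (shiftAbove d) (values M)))
    ≡⟨ cong (countB P) (cubeOver-map n (shiftAbove d) (values M)) ⟩
  countB P (map (Vec.map (shiftAbove d)) (cubeOver n (values M)))
    ≡⟨ countB-map P (Vec.map (shiftAbove d)) (cubeOver n (values M)) ⟩
  countB (P ∘ Vec.map (shiftAbove d)) (cubeOver n (values M))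
    ≡⟨ countB-cong P-inv (cubeOver n (values M)) ⟩
  countB P (cubeOver n (values M))
    ≡⟨ cong (countB P) (cube≡cubeOver n M) ⟨
  countB P (cube n M) ∎
  where
  open ≡-Reasoning
  M = d ℕ.+ k

-- Counting lattice points

surjCount : ∀ {n} → Config n → ℕ → ℕ → ℕ
surjCount {n} K d k = countB (λ c → isSurj d c ∧ K c) (cube n (d ℕ.+ k))

-- Split on whether d + 1 is taken; if it is not, squeeze it out with shiftAbove d.
surjCount-suc : ∀ {n} (K : Config n) → OrderInvariant K → ∀ d k →
  surjCount K d (suc k) ≡ surjCount K d k ℕ.+ surjCount K (suc d) k
surjCount-suc {n} K K-inv d k rewrite ℕ.+-suc d k = begin
  countB Q (cube n (suc M))
    ≡⟨ countB-split (hits (suc d)) Q (cube n (suc M)) ⟩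
  countB (λ c → not (hits (suc d) c) ∧ Q c) (cube n (suc M))
    ℕ.+ countB (λ c → hits (suc d) c ∧ Q c) (cube n (suc M))
    ≡⟨ cong₂ ℕ._+_ (countB-avoiding d k Q Q-inv) (countB-cong regroup (cube n (suc M))) ⟩
  countB Q (cube n M) ℕ.+ countB (λ c → isSurj (suc d) c ∧ K c) (cube n (suc M)) ∎
  where
  open ≡-Reasoning
  M = d ℕ.+ k
  Q : Vec ℕ n → Bool
  Q c = isSurj d c ∧ K c
  Q-inv : ∀ c → Q (Vec.map (shiftAbove d) c) ≡ Q c
  Q-inv c = cong₂ _∧_ (isSurj-shiftAbove d c) (K-inv (shiftAbove-mono d) c)
  regroup : ∀ c → hits (suc d) c ∧ Q c ≡ isSurj (suc d) c ∧ K c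
  regroup c = trans (sym (∧-assoc (hits (suc d) c) _ _))
    (cong (_∧ K c) (trans (∧-comm (hits (suc d) c) (isSurj d c)) (sym (isSurj-suc d c))))

countB-binomial : ∀ {n} (K : Config n) → OrderInvariant K → ∀ k N → k < N →
  + countB K (cube n k) ≡ sumTo N (λ j → + (k C j) * + fvec K j)
countB-binomial {n} K K-inv k N k<N = trans
  (binomial-of-pascal (λ d k → + surjCount K d k) W-suc k 0 N k<N)
  (sumTo-cong N (λ j _ → cong (λ z → + (k C j) * + countB (λ c → isSurj j c ∧ K c) (cube n z))
                              (ℕ.+-identityʳ j)))
  where
  W-suc : ∀ d k → + surjCount K d (suc k) ≡ + surjCount K d k + + surjCount K (suc d) k
  W-suc d k = trans (cong +_ (surjCount-suc K K-inv d k))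
                    (ℤ.pos-+ (surjCount K d k) (surjCount K (suc d) k))

countB-cube≡ehrhartSeries : ∀ {n} → 1 ≤ n → (K : Config n) → OrderInvariant K → ∀ k →
  + countB K (cube n k) ≡ ehrhartSeries K (suc k)
countB-cube≡ehrhartSeries {n} 1≤n K K-inv k = begin
  + countB K (cube n k)
    ≡⟨ countB-binomial K K-inv k (suc (k ⊔ n)) (s≤s (ℕ.m≤m⊔n k n)) ⟩
  sumTo (suc (k ⊔ n)) a
    ≡⟨ sumTo-stable (suc (k ⊔ n)) (λ j n<j → trans (cong (λ z → + (k C j) * + z) (fvec-beyond≡0 K j n<j))
                                                  (ℤ.*-zeroʳ (+ (k C j))))
                    (s≤s (ℕ.m≤n⊔m k n)) ⟩
  sumTo (suc n) a
    ≡⟨ sumTo-suc-head n a ⟩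
  + 1 * + fvec K 0 + sumTo n (a ∘ suc)
    ≡⟨ cong (λ z → + 1 * + z + sumTo n (a ∘ suc)) (fvec-0≡0 K 1≤n) ⟩
  + 0 + sumTo n (a ∘ suc)
    ≡⟨ ℤ.+-identityˡ _ ⟩
  sumTo n (a ∘ suc)
    ≡⟨ sumTo-cong n (λ i _ → trans (sym (ℤ.pos-* (k C suc i) _)) (cong +_ (ℕ.*-comm (k C suc i) _))) ⟩
  sumTo n (λ i → + (fvec K (suc i) ℕ.* (k C suc i))) ∎
  where
  open ≡-Reasoning
  a : ℕ → ℤ
  a j = + (k C j) * + fvec K j

onePlusT-countB-cube : ∀ {n} → 1 ≤ n → (K : Config n) → OrderInvariant K →
  onePlusT (λ k → + countB K (cube n k)) ≗ divOneMinusTPowSuc n (hPoly K)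
onePlusT-countB-cube {n} 1≤n K K-inv m =
  trans (onePlusT≗ehrhartSeries m) (sym (divOneMinusTPowSuc-mulOneMinusTPow n (ehrhartSeries K) m))
  where
  onePlusT≗ehrhartSeries : onePlusT (λ k → + countB K (cube n k)) ≗ ehrhartSeries K
  onePlusT≗ehrhartSeries zero    = refl
  onePlusT≗ehrhartSeries (suc k) = countB-cube≡ehrhartSeries 1≤n K K-inv k

countB-not-cube : ∀ {n} (K : Config n) k →
  + (k ^ n) - + countB K (cube n k) ≡ + countB (not ∘ K) (cube n k)
countB-not-cube {n} K k = begin
  + (k ^ n) - + a              ≡⟨ cong (λ z → + z - + a) (trans (sym (length-cube n k))
                                                               (sym (countB-+-countB-not K (cube n k)))) ⟩
  + (a ℕ.+ b) - + a            ≡⟨ cong (_- + a) (ℤ.pos-+ a b) ⟩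
  (+ a + + b) - + a            ≡⟨ solve 2 (λ x y → (x :+ y) :- x := y) refl (+ a) (+ b) ⟩
  + b                          ∎
  where
  open ≡-Reasoning
  a = countB K (cube n k)
  b = countB (not ∘ K) (cube n k)

mainTheorem2 : (n : ℕ) → 1 ≤ n → (S : Formula n) →
    ((m : ℕ) → onePlusT (λ k → + χ S k) m
                 ≡ divOneMinusTPowSuc n (hPoly (Allow S)) m)
    × ((m : ℕ) → onePlusT (λ k → (+ (k ^ n)) - (+ χ S k)) m
                 ≡ divOneMinusTPowSuc n (hPoly (Forb S)) m)
mainTheorem2 n 1≤n S = onePlusT-countB-cube 1≤n (Allow S) (eval-orderInvariant S) , forbidden
  where
  -- Forb S is Allow (¬f S).
  forbidden : (m : ℕ) →
    onePlusT (λ k → + (k ^ n) - + χ S k) m ≡ divOneMinusTPowSuc n (hPoly (Forb S)) m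
  forbidden zero    = onePlusT-countB-cube 1≤n (Forb S) (eval-orderInvariant (¬f S)) zero
  forbidden (suc k) = trans (countB-not-cube (Allow S) k)
                            (onePlusT-countB-cube 1≤n (Forb S) (eval-orderInvariant (¬f S)) (suc k))
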